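{- Let $n\ge 2$ and let $(p_1,\dots,p_{n-1})$ be positive integers with each $p_i\ge 2$ and $p_1+\cdots+p_{n-1}=3n-2$. Then there exists a path unfolding of the unit $n$-cube into $\mathbb{R}^{n-1}$ whose bounding box has side lengths $p_1,\dots,p_{n-1}$ (in some order of the coordinate axes).
   Context: A ridge unfolding of the $n$-cube cuts the cube along some of its ridges (codimension-two faces) so that the $2n$ facets remain connected along the uncut ridges and develop isometrically into $\mathbb{R}^{n-1}$. The uncut ridges determine a spanning tree of the graph whose vertices are the $2n$ facets and whose edges join facets sharing a ridge; the unfolding is a path unfolding if this spanning tree is a path. The bounding box of the unfolding is the smallest box (product of intervals) containing it with sides parallel to the ridges of the unfolded facets. -}

module Defs where

open import Data.Nat using (ℕ; suc; _∸_)
open import Data.Fin using (Fin; _≟_)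
open import Data.Bool using (Bool; true; false; if_then_else_; not)
open import Data.Integer using (ℤ; _+_; _-_; _⊔_; _⊓_; ∣_∣; 1ℤ; -1ℤ)
open import Data.Product using (_×_; _,_; proj₁)
open import Data.List using (List; []; _∷_; foldr)
open import Data.List.Relation.Unary.Linked using (Linked)
open import Data.List.Relation.Unary.Unique.Propositional using (Unique)
open import Data.List.Membership.Propositional using (_∈_)
open import Relation.Nullary using (¬_)
open import Relation.Nullary.Decidable using (⌊_⌋)
open import Relation.Binary.PropositionalEquality using (_≡_; _≢_)

-- Facets of the unit n-cube [0,1]^n: (i , true) is {x_i = 1}, (i , false) is {x_i = 0}.
Facet : ℕ → Set
Facet n = Fin n × Bool

-- Two facets share a ridge iff they are orthogonal (different axes).
ShareRidge : ∀ {n} → Facet n → Facet n → Set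
ShareRidge (i , _) (j , _) = i ≢ j

-- A developed position of the cube lying on the ground R^(n-1) (= hyperplane of the
-- currently developed facet).  The facet 'bottom' lies on the ground, occupying the
-- unit cell [cell , cell + 1] (coordinatewise) of Z^(n-1).  For each cube axis c other
-- than the bottom axis, 'axis c' is the ground axis parallel to it, and 'dir c' says
-- whether the cube's +e_c points in the positive ground direction.
record Placement (n : ℕ) : Set where
  constructor placement
  field
    bottom : Facet n
    axis   : Fin n → Fin (n ∸ 1)
    dir    : Fin n → Bool
    cell   : Fin (n ∸ 1) → ℤ
open Placement public

-- Initial placement is an isometric frame: the horizontal cube axes go to distinct
-- ground axes (hence bijectively, by counting).
ValidFrame : ∀ {n} → Placement n → Set
ValidFrame {n} P = ∀ c c' → c ≢ proj₁ (bottom P) → c' ≢ proj₁ (bottom P) →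
                   axis P c ≡ axis P c' → c ≡ c'

-- Unfold (rotate by 90 degrees) across the ridge shared by the bottom facet and the
-- adjacent facet f; the newly developed facet f lies in the neighbouring unit cell.
roll : ∀ {n} → Placement n → Facet n → Placement n
roll (placement (a , s) σ ε p) (b , t) =
  placement (b , t) σ' ε' p'
  where
    d : _
    d = σ b
    m : Bool            -- direction (true = +) of the move along ground axis d
    m = if t then ε b else not (ε b)
    σ' : _
    σ' c = if ⌊ c ≟ a ⌋ then d else σ c
    ε' : _
    ε' c = if ⌊ c ≟ a ⌋ then (if s then not m else m) else ε c
    p' : _
    p' g = if ⌊ g ≟ d ⌋ then p g + (if m then 1ℤ else -1ℤ) else p g

develop : ∀ {n} → Placement n → List (Facet n) → List (Placement n)
develop P []       = P ∷ []
develop P (f ∷ fs) = P ∷ develop (roll P f) fs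

-- A path unfolding of the n-cube: a Hamiltonian path start ∷ rest in the facet
-- adjacency graph (the uncut ridges are those between consecutive facets), together
-- with an initial isometric placement of the first facet.
record PathUnfolding (n : ℕ) : Set where
  field
    start  : Facet n
    rest   : List (Facet n)
    covers : ∀ f → f ∈ (start ∷ rest)
    unique : Unique (start ∷ rest)
    linked : Linked ShareRidge (start ∷ rest)
    frame  : Placement n
    frameBottom : bottom frame ≡ start
    frameValid  : ValidFrame frame
open PathUnfolding public

boxSide : ∀ {n} → PathUnfolding n → Fin (n ∸ 1) → ℕ
boxSide U g = suc ∣ hi - lo ∣
  where
    Ps = develop (frame U) (rest U)
    hi = foldr (λ Q r → cell Q g ⊔ r) (cell (frame U) g) Ps
    lo = foldr (λ Q r → cell Q g ⊓ r) (cell (frame U) g) Ps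

module Submission where

open import Defs
open import Data.Nat using (ℕ; _≤_; _*_; _∸_)
open import Data.Fin using (Fin)
open import Data.Fin.Permutation using (Permutation′; _⟨$⟩ʳ_)
open import Data.List using (tabulate)
open import Data.Nat.ListAction using (sum)
open import Data.Product using (Σ; ∃)
open import Relation.Binary.PropositionalEquality using (_≡_)

open import Data.Nat using (zero; suc; _+_; z≤n; s≤s)
open import Data.Nat.Properties using (⊔-identityʳ; ⊓-zeroʳ; m≤n⇒m⊔n≡n; ≤-trans; m≤m+n; +-assoc; *-suc; +-identityʳ; *-identityˡ; +-cancelˡ-≡; +-cancelʳ-≡; *-identityʳ; *-comm; m+[n∸m]≡n; ∸-monoˡ-≤; suc-injective)
open import Data.Nat.Tactic.RingSolver using (solve-∀)
open import Data.Nat.ListAction.Properties using (sum-++; sum-↭)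
open import Data.Bool using (true; false; not; if_then_else_)
import Data.Integer as ℤ
import Data.Integer.Properties as ℤProperties
open import Data.Integer using (0ℤ) renaming (_+_ to _+ℤ_; _⊔_ to _⊔ℤ_; _⊓_ to _⊓ℤ_)
open import Data.Fin using (zero; suc; _≟_)
import Data.Fin.Permutation as Permutation
open import Data.List using (List; []; _∷_; _++_; [_]; length; map; foldr; allFin; cartesianProduct; cartesianProductWith)
open import Data.List.Properties using (++-assoc; length-++; map-++; length-tabulate; map-tabulate)
open import Data.List.Membership.Propositional using (_∈_; _∉_)
open import Data.List.Membership.Propositional.Properties using (∈-++⁺ˡ; ∈-++⁺ʳ; ∈-++⁻; ∈-allFin; ∈-cartesianProduct⁺)
open import Data.List.Relation.Unary.Any using (here; there)
open import Data.List.Relation.Unary.All using (All; []; _∷_)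
import Data.List.Relation.Unary.All as All
import Data.List.Relation.Unary.All.Properties as AllProperties
open import Data.List.Relation.Unary.AllPairs using ([]; _∷_)
import Data.List.Relation.Unary.AllPairs as AllPairs
open import Data.List.Relation.Unary.Linked using (Linked; [-]; _∷_)
open import Data.List.Relation.Unary.Unique.Propositional using (Unique)
open import Data.List.Relation.Unary.Unique.Propositional.Properties using (allFin⁺; cartesianProduct⁺; Unique[x∷xs]⇒x∉xs)
open import Data.List.Relation.Binary.Permutation.Propositional using (_↭_; prep; swap; ↭-refl; ↭-sym; ↭-trans; ↭-reflexive; ↭⇒↭ₛ; module PermutationReasoning)
open import Data.List.Relation.Binary.Permutation.Propositional.Properties using (++⁺; ++⁺ˡ; ++⁺ʳ; shift; shifts; ∷↭∷ʳ; ↭-length; ∈-resp-↭; map⁺)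
import Data.List.Relation.Binary.Permutation.Setoid.Properties as SetoidPermutation
open import Data.Vec.Functional using (updateAt)
open import Data.Vec.Functional.Properties using (updateAt-updates; updateAt-minimal)
open import Data.Product using (_×_; _,_; proj₁; proj₂)
open import Data.Sum using (_⊎_; inj₁; inj₂)
open import Data.Empty using (⊥-elim)
open import Function using (const; id; _∘_)
open import Relation.Nullary using (yes; no; contradiction)
open import Relation.Nullary.Decidable using (⌊_⌋)
open import Relation.Binary.PropositionalEquality using (_≢_; refl; sym; trans; cong; cong₂; subst; setoid; module ≡-Reasoning)

-- Put the cube on the ground R^m (m = n - 1) and roll it, only in positive ground
-- directions, along a word w over the ground axes.  The facets put on the ground form a
-- path in the facet graph and the ground cell only moves up, so the bounding box side along
-- axis g is 1 + (number of g's in w).  It therefore suffices to find a word with c g = p g - 1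
-- letters g (so Σ c = 2m + 1 = 2n - 1 rolls) along which every facet is put down once.
--
-- Rolling: an abstract model of rolling and "tours" of a set G of axes (words that put
--   down the top and the two facets of each axis in G once each); tours are built as fans
--   b b x₁ b x₂ … b xₖ b b, by splicing two tours with one letter, and by bracketing h … h.
-- Demands, Assembly: the letter counts of these tours; sorting the axes by c ∈ {1, 2, ≥ 3},
--   the axes with c ≥ 3 carry fans that absorb exactly the axes with c = 1 (by Σ c = 2m + 1),
--   and the axes with c = 2 bracket the result.

unique-↭ : ∀ {A : Set} {xs ys : List A} → xs ↭ ys → Unique xs → Unique ys
unique-↭ {A} xs↭ys = SetoidPermutation.Unique-resp-↭ (setoid A) (↭⇒↭ₛ xs↭ys)

unique-prefix : ∀ {A : Set} (xs : List A) {ys} → Unique (xs ++ ys) → Unique xs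
unique-prefix []       _          = []
unique-prefix (x ∷ xs) (x∉ ∷ xs!) = AllProperties.++⁻ˡ xs x∉ ∷ unique-prefix xs xs!

unique-suffix : ∀ {A : Set} (xs : List A) {ys} → Unique (xs ++ ys) → Unique ys
unique-suffix []       ys!       = ys!
unique-suffix (x ∷ xs) (_ ∷ xs!) = unique-suffix xs xs!

unique-disjoint : ∀ {A : Set} (xs : List A) {ys a} → Unique (xs ++ ys) → a ∈ xs → a ∉ ys
unique-disjoint (x ∷ xs) (x∉ ∷ _) (here refl) a∈ys = All.lookup (AllProperties.++⁻ʳ xs x∉) a∈ys refl
unique-disjoint (x ∷ xs) (_ ∷ xs!) (there a∈xs) = unique-disjoint xs xs! a∈xs

chop : ∀ {A : Set} k {N} (xs : List A) → length xs ≡ k + suc N →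
       Σ (List A) λ ys → Σ A λ x → Σ (List A) λ zs →
         xs ≡ ys ++ x ∷ zs × length ys ≡ k × length zs ≡ N
chop zero    (x ∷ zs) |xs| = [] , x , zs , refl , refl , suc-injective |xs|
chop (suc k) (y ∷ xs) |xs| with chop k xs (suc-injective |xs|)
... | ys , x , zs , refl , |ys| , |zs| = y ∷ ys , x , zs , refl , cong suc |ys| , |zs|

if-same : ∀ {A : Set} {n} (a : Fin n) {x y : A} → (if ⌊ a ≟ a ⌋ then x else y) ≡ x
if-same a with a ≟ a
... | yes _   = refl
... | no  a≢a = contradiction refl a≢a

if-diff : ∀ {A : Set} {n} {a b : Fin n} {x y : A} → a ≢ b → (if ⌊ a ≟ b ⌋ then x else y) ≡ y
if-diff {a = a} {b} a≢b with a ≟ b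
... | yes a≡b = contradiction a≡b a≢b
... | no  _   = refl

weave : ∀ {A : Set} → A → List A → List A
weave b []       = b ∷ b ∷ []
weave b (y ∷ ys) = b ∷ y ∷ weave b ys

fan : ∀ {A : Set} → A → List A → List A
fan b ys = b ∷ weave b ys

weave-letters : ∀ {A : Set} (b : A) ys {g} → g ∈ weave b ys → g ∈ b ∷ ys
weave-letters b []       (here g≡b)         = here g≡b
weave-letters b []       (there (here g≡b)) = here g≡b
weave-letters b (y ∷ ys) (here g≡b)         = here g≡b
weave-letters b (y ∷ ys) (there (here g≡y)) = there (here g≡y)
weave-letters b (y ∷ ys) (there (there g∈)) with weave-letters b ys g∈
... | here g≡b  = here g≡b
... | there g∈ys = there (there g∈ys)

δ : ∀ {m} → Fin m → Fin m → ℕ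
δ g h = if ⌊ g ≟ h ⌋ then 1 else 0

occ : ∀ {m} → Fin m → List (Fin m) → ℕ
occ g []      = 0
occ g (h ∷ w) = δ g h + occ g w

occ-++ : ∀ {m} (g : Fin m) w₁ w₂ → occ g (w₁ ++ w₂) ≡ occ g w₁ + occ g w₂
occ-++ g []       w₂ = refl
occ-++ g (h ∷ w₁) w₂ = trans (cong (δ g h +_) (occ-++ g w₁ w₂)) (sym (+-assoc (δ g h) _ _))

occ-weave : ∀ {m} (g b : Fin m) ys → occ g (weave b ys) ≡ (2 + length ys) * δ g b + occ g ys
occ-weave g b []       = sym (+-identityʳ _)
occ-weave g b (y ∷ ys) = trans (cong (λ r → δ g b + (δ g y + r)) (occ-weave g b ys))
                               (rearrange (δ g b) (δ g y) (length ys) (occ g ys))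
  where
    rearrange : ∀ d e L C → d + (e + ((2 + L) * d + C)) ≡ (2 + suc L) * d + (e + C)
    rearrange = solve-∀

occ-fan : ∀ {m} (g b : Fin m) ys → occ g (fan b ys) ≡ (3 + length ys) * δ g b + occ g ys
occ-fan g b ys = trans (cong (δ g b +_) (occ-weave g b ys)) (sym (+-assoc (δ g b) _ _))

-- An abstract model of rolling a cube on the ground R^m in positive directions only.
-- X is the set of facets and opp maps a facet to the opposite one.
module Rolling {X : Set} (opp : X → X) (m : ℕ) where

  -- The facet on the ground, and for each ground axis g the facet that lands on the
  -- ground when the cube is rolled one step in direction +g.
  record State : Set where
    constructor state
    field
      down : X
      next : Fin m → X
  open State public

  -- Rolling along g: the facet ahead along g goes down, the old top comes up ahead.
  step : Fin m → State → State
  step g (state B F) = state (F g) (updateAt F g (const (opp B)))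

  trail : State → List (Fin m) → List X
  trail S []      = []
  trail S (g ∷ w) = next S g ∷ trail (step g S) w

  after : State → List (Fin m) → State
  after S []      = S
  after S (g ∷ w) = after (step g S) w

  trail-++ : ∀ S w₁ w₂ → trail S (w₁ ++ w₂) ≡ trail S w₁ ++ trail (after S w₁) w₂
  trail-++ S []       w₂ = refl
  trail-++ S (g ∷ w₁) w₂ = cong (next S g ∷_) (trail-++ (step g S) w₁ w₂)

  after-untouched : ∀ S w {g} → g ∉ w → next (after S w) g ≡ next S g
  after-untouched S []      _   = refl
  after-untouched S (h ∷ w) g∉ =
    trans (after-untouched (step h S) w (g∉ ∘ there))
          (updateAt-minimal _ h (next S) (g∉ ∘ here))

  flanks : (Fin m → X) → List (Fin m) → List X
  flanks F []      = []
  flanks F (g ∷ G) = F g ∷ opp (F g) ∷ flanks F G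

  flanks-local : ∀ {F F′} G → (∀ {g} → g ∈ G → F g ≡ F′ g) → flanks F G ≡ flanks F′ G
  flanks-local []      _  = refl
  flanks-local (g ∷ G) eq =
    cong₂ (λ x l → x ∷ opp x ∷ l) (eq (here refl)) (flanks-local G (eq ∘ there))

  flanks-++ : ∀ F G₁ G₂ → flanks F (G₁ ++ G₂) ≡ flanks F G₁ ++ flanks F G₂
  flanks-++ F []       G₂ = refl
  flanks-++ F (g ∷ G₁) G₂ = cong (λ l → F g ∷ opp (F g) ∷ l) (flanks-++ F G₁ G₂)

  flanks-↭ : ∀ F {G G′} → G ↭ G′ → flanks F G ↭ flanks F G′
  flanks-↭ F _↭_.refl          = ↭-refl
  flanks-↭ F (prep g G↭G′)     = prep (F g) (prep (opp (F g)) (flanks-↭ F G↭G′))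
  flanks-↭ F (swap g h G↭G′)   =
    ↭-trans (shifts (F g ∷ opp (F g) ∷ []) (F h ∷ opp (F h) ∷ []))
            (++⁺ˡ (F h ∷ opp (F h) ∷ F g ∷ opp (F g) ∷ []) (flanks-↭ F G↭G′))
  flanks-↭ F (_↭_.trans p q)   = ↭-trans (flanks-↭ F p) (flanks-↭ F q)

  -- w tours G: from every position, rolling along w puts on the ground exactly the top
  -- facet and the facets flanking the axes of G, each once; and w only uses axes of G.
  record Tour (G w : List (Fin m)) : Set where
    field
      visits  : ∀ S → trail S w ↭ opp (down S) ∷ flanks (next S) G
      letters : ∀ {g} → g ∈ w → g ∈ G
  open Tour public

  tour-↭ : ∀ {G G′ w} → G ↭ G′ → Tour G w → Tour G′ w
  visits  (tour-↭ G↭G′ t) S = ↭-trans (visits t S) (prep _ (flanks-↭ (next S) G↭G′))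
  letters (tour-↭ G↭G′ t) g∈ = ∈-resp-↭ G↭G′ (letters t g∈)

  weave-visits : ∀ b ys S → b ∉ ys → Unique ys →
                 trail S (weave b ys) ↭ next S b ∷ opp (down S) ∷ flanks (next S) ys
  weave-visits b [] (state B F) _ _ =
    ↭-reflexive (cong (λ x → F b ∷ x ∷ []) (updateAt-updates b F))
  weave-visits b (y ∷ ys) (state B F) b∉ (y∉ys ∷ ys!) = begin
      F b ∷ F₁ y ∷ trail (state (F₁ y) F₂) (weave b ys)
    ↭⟨ prep (F b) (prep (F₁ y) (weave-visits b ys (state (F₁ y) F₂) (b∉ ∘ there) ys!)) ⟩
      F b ∷ F₁ y ∷ F₂ b ∷ opp (F₁ y) ∷ flanks F₂ ys
    ≡⟨ cong (λ x → F b ∷ x ∷ F₂ b ∷ opp x ∷ flanks F₂ ys) F₁y ⟩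
      F b ∷ F y ∷ F₂ b ∷ opp (F y) ∷ flanks F₂ ys
    ≡⟨ cong₂ (λ x l → F b ∷ F y ∷ x ∷ opp (F y) ∷ l) F₂b F₂ys ⟩
      F b ∷ F y ∷ opp B ∷ opp (F y) ∷ flanks F ys
    ↭⟨ prep (F b) (swap (F y) (opp B) ↭-refl) ⟩
      F b ∷ opp B ∷ F y ∷ opp (F y) ∷ flanks F ys ∎
    where
      open PermutationReasoning
      F₁ F₂ : Fin m → X
      F₁ = updateAt F b (const (opp B))
      F₂ = updateAt F₁ y (const (opp (F b)))
      y≢b : y ≢ b
      y≢b y≡b = b∉ (here (sym y≡b))
      F₁y : F₁ y ≡ F y
      F₁y = updateAt-minimal y b F y≢b
      F₂b : F₂ b ≡ opp B
      F₂b = trans (updateAt-minimal b y F₁ (y≢b ∘ sym)) (updateAt-updates b F)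
      F₂ys : flanks F₂ ys ≡ flanks F ys
      F₂ys = flanks-local ys λ g∈ →
        trans (updateAt-minimal _ y F₁ (λ g≡y → All.lookup y∉ys g∈ (sym g≡y)))
              (updateAt-minimal _ b F (λ g≡b → b∉ (there (subst (_∈ ys) g≡b g∈))))

  fan-tour : ∀ b xs → Unique (b ∷ xs) → Tour (b ∷ xs) (fan b xs)
  visits  (fan-tour b xs (b∉xs ∷ xs!)) (state B F) = begin
      F b ∷ trail (state (F b) F₁) (weave b xs)
    ↭⟨ prep (F b) (weave-visits b xs (state (F b) F₁) b∉ xs!) ⟩
      F b ∷ F₁ b ∷ opp (F b) ∷ flanks F₁ xs
    ≡⟨ cong₂ (λ x l → F b ∷ x ∷ opp (F b) ∷ l) (updateAt-updates b F) F₁xs ⟩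
      F b ∷ opp B ∷ opp (F b) ∷ flanks F xs
    ↭⟨ swap (F b) (opp B) ↭-refl ⟩
      opp B ∷ F b ∷ opp (F b) ∷ flanks F xs ∎
    where
      open PermutationReasoning
      F₁ : Fin m → X
      F₁ = updateAt F b (const (opp B))
      b∉ : b ∉ xs
      b∉ = Unique[x∷xs]⇒x∉xs (b∉xs ∷ xs!)
      F₁xs : flanks F₁ xs ≡ flanks F xs
      F₁xs = flanks-local xs λ g∈ → updateAt-minimal _ b F (λ g≡b → b∉ (subst (_∈ xs) g≡b g∈))
  letters (fan-tour b xs _) (here g≡b) = here g≡b
  letters (fan-tour b xs _) (there g∈) = weave-letters b xs g∈

  splice-tour : ∀ {G₁ G₂ w₁ w₂} x → Tour G₁ w₁ → Tour G₂ w₂ → Unique (G₁ ++ x ∷ G₂) →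
                Tour (G₁ ++ x ∷ G₂) (w₁ ++ x ∷ w₂)
  visits (splice-tour {G₁} {G₂} {w₁} {w₂} x t₁ t₂ G!) S = begin
      trail S (w₁ ++ x ∷ w₂)
    ≡⟨ trail-++ S w₁ (x ∷ w₂) ⟩
      trail S w₁ ++ next S₁ x ∷ trail (step x S₁) w₂
    ↭⟨ ++⁺ (visits t₁ S) (prep (next S₁ x) (visits t₂ (step x S₁))) ⟩
      opp (down S) ∷ flanks (next S) G₁ ++ next S₁ x ∷ opp (next S₁ x) ∷ flanks (next (step x S₁)) G₂
    ≡⟨ cong (λ l → opp (down S) ∷ flanks (next S) G₁ ++ l) second-half ⟩
      opp (down S) ∷ flanks (next S) G₁ ++ flanks (next S) (x ∷ G₂)
    ≡⟨ cong (opp (down S) ∷_) (flanks-++ (next S) G₁ (x ∷ G₂)) ⟨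
      opp (down S) ∷ flanks (next S) (G₁ ++ x ∷ G₂) ∎
    where
      open PermutationReasoning
      S₁ : State
      S₁ = after S w₁
      outside-w₁ : ∀ {g} → g ∈ x ∷ G₂ → g ∉ w₁
      outside-w₁ g∈ g∈w₁ = unique-disjoint G₁ G! (letters t₁ g∈w₁) g∈
      x∉G₂ : x ∉ G₂
      x∉G₂ = Unique[x∷xs]⇒x∉xs (unique-suffix G₁ G!)
      second-half : next S₁ x ∷ opp (next S₁ x) ∷ flanks (next (step x S₁)) G₂
                    ≡ flanks (next S) (x ∷ G₂)
      second-half = cong₂ (λ u l → u ∷ opp u ∷ l)
        (after-untouched S w₁ (outside-w₁ (here refl)))
        (flanks-local G₂ λ g∈ →
          trans (updateAt-minimal _ x (next S₁) (λ g≡x → x∉G₂ (subst (_∈ G₂) g≡x g∈)))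
                (after-untouched S w₁ (outside-w₁ (there g∈))))
  letters (splice-tour {G₁} {w₁ = w₁} x t₁ t₂ _) g∈ with ∈-++⁻ w₁ g∈
  ... | inj₁ g∈w₁         = ∈-++⁺ˡ (letters t₁ g∈w₁)
  ... | inj₂ (here g≡x)   = ∈-++⁺ʳ G₁ (here g≡x)
  ... | inj₂ (there g∈w₂) = ∈-++⁺ʳ G₁ (there (letters t₂ g∈w₂))

  bracket-tour : ∀ {G w} h → Tour G w → h ∉ G → Tour (h ∷ G) (h ∷ w ++ [ h ])
  visits (bracket-tour {G} {w} h t h∉G) (state B F) = begin
      F h ∷ trail S₁ (w ++ [ h ])
    ≡⟨ cong (F h ∷_) (trail-++ S₁ w [ h ]) ⟩
      F h ∷ trail S₁ w ++ [ next (after S₁ w) h ]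
    ≡⟨ cong (λ x → F h ∷ trail S₁ w ++ [ x ])
            (trans (after-untouched S₁ w (h∉G ∘ letters t)) (updateAt-updates h F)) ⟩
      F h ∷ trail S₁ w ++ [ opp B ]
    ↭⟨ prep (F h) (++⁺ʳ [ opp B ] (visits t S₁)) ⟩
      F h ∷ (opp (F h) ∷ flanks F₁ G) ++ [ opp B ]
    ↭⟨ prep (F h) (∷↭∷ʳ (opp B) _) ⟨
      F h ∷ opp B ∷ opp (F h) ∷ flanks F₁ G
    ↭⟨ swap (F h) (opp B) ↭-refl ⟩
      opp B ∷ F h ∷ opp (F h) ∷ flanks F₁ G
    ≡⟨ cong (λ l → opp B ∷ F h ∷ opp (F h) ∷ l) F₁G ⟩
      opp B ∷ flanks F (h ∷ G) ∎
    where
      open PermutationReasoning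
      F₁ : Fin m → X
      F₁ = updateAt F h (const (opp B))
      S₁ : State
      S₁ = state (F h) F₁
      F₁G : flanks F₁ G ≡ flanks F G
      F₁G = flanks-local G λ g∈ → updateAt-minimal _ h F (λ g≡h → h∉G (subst (_∈ G) g≡h g∈))
  letters (bracket-tour h t _) (here g≡h) = here g≡h
  letters (bracket-tour {w = w} h t _) (there g∈) with ∈-++⁻ w g∈
  ... | inj₁ g∈w         = there (letters t g∈w)
  ... | inj₂ (here g≡h) = here g≡h

module Demands {m : ℕ} (c : Fin m → ℕ) where

  demand : Fin m → List (Fin m) → ℕ
  demand g []      = 0
  demand g (h ∷ G) = δ g h * c h + demand g G

  Meets : List (Fin m) → List (Fin m) → Set
  Meets G w = ∀ g → occ g w ≡ demand g G

  demand-++ : ∀ g G₁ G₂ → demand g (G₁ ++ G₂) ≡ demand g G₁ + demand g G₂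
  demand-++ g []       G₂ = refl
  demand-++ g (h ∷ G₁) G₂ =
    trans (cong (δ g h * c h +_) (demand-++ g G₁ G₂)) (sym (+-assoc (δ g h * c h) _ _))

  demand-ones : ∀ g {xs} → All (λ x → c x ≡ 1) xs → demand g xs ≡ occ g xs
  demand-ones g []          = refl
  demand-ones g (cx ∷ cxs) =
    cong₂ _+_ (trans (cong (δ g _ *_) cx) (*-identityʳ _)) (demand-ones g cxs)

  demand-absent : ∀ {g} G → g ∉ G → demand g G ≡ 0
  demand-absent []      _  = refl
  demand-absent (h ∷ G) g∉ =
    cong₂ _+_ (cong (_* c h) (if-diff (g∉ ∘ here))) (demand-absent G (g∉ ∘ there))

  demand-unique : ∀ {g} G → Unique G → g ∈ G → demand g G ≡ c g
  demand-unique {g} (g ∷ G) G! (here refl) =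
    trans (cong₂ _+_ (cong (_* c g) (if-same g)) (demand-absent G (Unique[x∷xs]⇒x∉xs G!)))
          (trans (+-identityʳ _) (*-identityˡ (c g)))
  demand-unique {g} (h ∷ G) G!@(_ ∷ G′!) (there g∈) =
    cong₂ _+_ (cong (_* c h) (if-diff λ g≡h → Unique[x∷xs]⇒x∉xs G! (subst (_∈ G) g≡h g∈)))
              (demand-unique G G′! g∈)

  fan-meets : ∀ b xs → c b ≡ 3 + length xs → All (λ x → c x ≡ 1) xs → Meets (b ∷ xs) (fan b xs)
  fan-meets b xs cb cxs g = begin
      occ g (fan b xs)                 ≡⟨ occ-fan g b xs ⟩
      (3 + length xs) * δ g b + occ g xs ≡⟨ cong₂ _+_ (*-comm (3 + length xs) (δ g b)) (sym (demand-ones g cxs)) ⟩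
      δ g b * (3 + length xs) + demand g xs ≡⟨ cong (λ k → δ g b * k + demand g xs) cb ⟨
      demand g (b ∷ xs)                ∎
    where open ≡-Reasoning

  splice-meets : ∀ {G₁ G₂ w₁ w₂} x → c x ≡ 1 → Meets G₁ w₁ → Meets G₂ w₂ →
                 Meets (G₁ ++ x ∷ G₂) (w₁ ++ x ∷ w₂)
  splice-meets {G₁} {G₂} {w₁} {w₂} x cx m₁ m₂ g = begin
      occ g (w₁ ++ x ∷ w₂)                        ≡⟨ occ-++ g w₁ (x ∷ w₂) ⟩
      occ g w₁ + (δ g x + occ g w₂)                ≡⟨ cong₂ (λ a b → a + (b + occ g w₂)) (m₁ g) (sym (*-identityʳ (δ g x))) ⟩
      demand g G₁ + (δ g x * 1 + occ g w₂)         ≡⟨ cong₂ (λ a b → demand g G₁ + (δ g x * a + b)) (sym cx) (m₂ g) ⟩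
      demand g G₁ + demand g (x ∷ G₂)             ≡⟨ demand-++ g G₁ (x ∷ G₂) ⟨
      demand g (G₁ ++ x ∷ G₂)                     ∎
    where open ≡-Reasoning

  bracket-meets : ∀ {G w} h → c h ≡ 2 → Meets G w → Meets (h ∷ G) (h ∷ w ++ [ h ])
  bracket-meets {G} {w} h ch m′ g = begin
      δ g h + occ g (w ++ [ h ])            ≡⟨ cong (δ g h +_) (occ-++ g w [ h ]) ⟩
      δ g h + (occ g w + (δ g h + 0))       ≡⟨ cong (λ a → δ g h + (a + (δ g h + 0))) (m′ g) ⟩
      δ g h + (demand g G + (δ g h + 0))    ≡⟨ rearrange (δ g h) (demand g G) ⟩
      δ g h * 2 + demand g G               ≡⟨ cong (λ k → δ g h * k + demand g G) ch ⟨
      demand g (h ∷ G)                     ∎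
    where
      open ≡-Reasoning
      rearrange : ∀ d a → d + (a + (d + 0)) ≡ d * 2 + a
      rearrange = solve-∀

module Assembly {X : Set} (opp : X → X) (m : ℕ) (c : Fin m → ℕ) where
  open Rolling opp m
  open Demands c

  record Route (G : List (Fin m)) : Set where
    constructor route
    field
      word  : List (Fin m)
      tour  : Tour G word
      meets : Meets G word

  fan-route : ∀ b xs → Unique (b ∷ xs) → c b ≡ 3 + length xs → All (λ x → c x ≡ 1) xs →
              Route (b ∷ xs)
  fan-route b xs U cb cxs = route (fan b xs) (fan-tour b xs U) (fan-meets b xs cb cxs)

  splice-route : ∀ {G₁ G₂} x → c x ≡ 1 → Route G₁ → Route G₂ → Unique (G₁ ++ x ∷ G₂) →
                 Route (G₁ ++ x ∷ G₂)
  splice-route {G₁} {G₂} x cx (route w₁ t₁ m₁) (route w₂ t₂ m₂) U =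
    route (w₁ ++ x ∷ w₂) (splice-tour x t₁ t₂ U) (splice-meets {G₁} {G₂} {w₁} {w₂} x cx m₁ m₂)

  bracket-route : ∀ {G} h → c h ≡ 2 → Route G → h ∉ G → Route (h ∷ G)
  bracket-route {G} h ch (route w t m′) h∉G =
    route (h ∷ w ++ [ h ]) (bracket-tour h t h∉G) (bracket-meets {G} {w} h ch m′)

  bracket-all : ∀ T {G} → All (λ h → c h ≡ 2) T → Route G → Unique (T ++ G) → Route (T ++ G)
  bracket-all []      _          R _          = R
  bracket-all (h ∷ T) (ch ∷ cT) R U@(_ ∷ U′) =
    bracket-route h ch (bracket-all T cT R U′) (Unique[x∷xs]⇒x∉xs U)

  -- The number of axes with c = 1 used by fans on the axes b ∷ bs (each with c ≥ 3):
  -- c - 3 inside each fan, plus one between consecutive fans.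
  onesNeeded : Fin m → List (Fin m) → ℕ
  onesNeeded b []        = c b ∸ 3
  onesNeeded b (b′ ∷ bs) = (c b ∸ 3) + suc (onesNeeded b′ bs)

  bigs-total : ∀ b bs → All (λ h → 3 ≤ c h) (b ∷ bs) →
               sum (map c (b ∷ bs)) ≡ 3 + onesNeeded b bs + 2 * length bs
  bigs-total b []        (b3 ∷ [])  = cong (_+ 0) (sym (m+[n∸m]≡n b3))
  bigs-total b (b′ ∷ bs) (b3 ∷ bs3) = begin
      c b + sum (map c (b′ ∷ bs))
    ≡⟨ cong₂ _+_ (sym (m+[n∸m]≡n b3)) (bigs-total b′ bs bs3) ⟩
      (3 + (c b ∸ 3)) + (3 + onesNeeded b′ bs + 2 * length bs)
    ≡⟨ rearrange (c b ∸ 3) (onesNeeded b′ bs) (length bs) ⟩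
      3 + onesNeeded b (b′ ∷ bs) + 2 * length (b′ ∷ bs) ∎
    where
      open ≡-Reasoning
      rearrange : ∀ k N L → (3 + k) + (3 + N + 2 * L) ≡ 3 + (k + suc N) + 2 * suc L
      rearrange = solve-∀

  chain : ∀ b bs ones → All (λ h → 3 ≤ c h) (b ∷ bs) → All (λ h → c h ≡ 1) ones →
          length ones ≡ onesNeeded b bs → Unique ((b ∷ bs) ++ ones) →
          Σ (List (Fin m)) λ G → G ↭ (b ∷ bs) ++ ones × Route G
  chain b [] ones (b3 ∷ []) cones |ones| U =
    b ∷ ones , ↭-refl , fan-route b ones U (trans (sym (m+[n∸m]≡n b3)) (cong (3 +_) (sym |ones|))) cones
  chain b (b′ ∷ bs) ones (b3 ∷ bs3) cones |ones| U with chop (c b ∸ 3) ones |ones|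
  ... | xs , x , ys , refl , |xs| , |ys| =
    (b ∷ xs) ++ x ∷ G₂ , arranged ,
    splice-route x (All.head cx∷ys) (fan-route b xs U-fan cb (AllProperties.++⁻ˡ xs cones)) R₂ U-G
    where
      open PermutationReasoning
      rs : List (Fin m)
      rs = b′ ∷ bs
      cx∷ys : All (λ h → c h ≡ 1) (x ∷ ys)
      cx∷ys = AllProperties.++⁻ʳ xs cones
      cb : c b ≡ 3 + length xs
      cb = trans (sym (m+[n∸m]≡n b3)) (cong (3 +_) (sym |xs|))
      regroup : (b ∷ xs) ++ x ∷ rs ++ ys ↭ (b ∷ rs) ++ xs ++ x ∷ ys
      regroup = prep b (begin
          xs ++ x ∷ rs ++ ys           ≡⟨ ++-assoc xs [ x ] (rs ++ ys) ⟨
          (xs ++ [ x ]) ++ rs ++ ys    ↭⟨ shifts (xs ++ [ x ]) rs ⟩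
          rs ++ (xs ++ [ x ]) ++ ys    ≡⟨ cong (rs ++_) (++-assoc xs [ x ] ys) ⟩
          rs ++ xs ++ x ∷ ys           ∎)
      later : Σ (List (Fin m)) λ G → G ↭ rs ++ ys × Route G
      later = chain b′ bs ys bs3 (All.tail cx∷ys) |ys|
               (AllPairs.tail (unique-suffix (b ∷ xs) (unique-↭ (↭-sym regroup) U)))
      G₂ : List (Fin m)
      G₂ = proj₁ later
      R₂ : Route G₂
      R₂ = proj₂ (proj₂ later)
      arranged : (b ∷ xs) ++ x ∷ G₂ ↭ (b ∷ rs) ++ xs ++ x ∷ ys
      arranged = ↭-trans (++⁺ˡ (b ∷ xs) (prep x (proj₁ (proj₂ later)))) regroup
      U-G : Unique ((b ∷ xs) ++ x ∷ G₂)
      U-G = unique-↭ (↭-sym arranged) U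
      U-fan : Unique (b ∷ xs)
      U-fan = unique-prefix (b ∷ xs) U-G

  classify : ∀ x → 1 ≤ x → x ≡ 1 ⊎ x ≡ 2 ⊎ 3 ≤ x
  classify 1                   _ = inj₁ refl
  classify 2                   _ = inj₂ (inj₁ refl)
  classify (suc (suc (suc x))) _ = inj₂ (inj₂ (s≤s (s≤s (s≤s z≤n))))

  record Sorted (L : List (Fin m)) : Set where
    constructor sorted
    field
      twos bigs ones : List (Fin m)
      arranged : twos ++ bigs ++ ones ↭ L
      twos-two : All (λ h → c h ≡ 2) twos
      bigs-big : All (λ h → 3 ≤ c h) bigs
      ones-one : All (λ h → c h ≡ 1) ones

  sort : ∀ L → All (λ h → 1 ≤ c h) L → Sorted L
  sort []      []           = sorted [] [] [] ↭-refl [] [] []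
  sort (h ∷ L) (h≥1 ∷ L≥1) with sort L L≥1 | classify (c h) h≥1
  ... | sorted T B O arr cT cB cO | inj₁ one =
    sorted T B (h ∷ O) (↭-trans (++⁺ˡ T (shift h B O)) (↭-trans (shift h T (B ++ O)) (prep h arr)))
           cT cB (one ∷ cO)
  ... | sorted T B O arr cT cB cO | inj₂ (inj₁ two) =
    sorted (h ∷ T) B O (prep h arr) (two ∷ cT) cB cO
  ... | sorted T B O arr cT cB cO | inj₂ (inj₂ big) =
    sorted T (h ∷ B) O (↭-trans (shift h T (B ++ O)) (prep h arr)) cT (big ∷ cB) cO

  sum-twos : ∀ {T} → All (λ h → c h ≡ 2) T → sum (map c T) ≡ 2 * length T
  sum-twos []                = refl
  sum-twos {_ ∷ T} (ch ∷ cT) =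
    trans (cong₂ _+_ ch (sum-twos cT)) (sym (*-suc 2 (length T)))

  sum-ones : ∀ {O} → All (λ h → c h ≡ 1) O → sum (map c O) ≡ length O
  sum-ones []        = refl
  sum-ones (ch ∷ cO) = cong₂ _+_ ch (sum-ones cO)

  balance : ∀ {L} T B O → T ++ B ++ O ↭ L → All (λ h → c h ≡ 2) T → All (λ h → c h ≡ 1) O →
            sum (map c L) ≡ 2 * length L + 1 →
            2 * length T + (sum (map c B) + length O) ≡ 2 * (length T + (length B + length O)) + 1
  balance {L} T B O arr cT cO total = begin
      2 * length T + (sum (map c B) + length O)
    ≡⟨ cong₂ (λ t o → t + (sum (map c B) + o)) (sum-twos cT) (sum-ones cO) ⟨
      sum (map c T) + (sum (map c B) + sum (map c O))
    ≡⟨ cong (sum (map c T) +_) (trans (cong sum (map-++ c B O)) (sum-++ (map c B) (map c O))) ⟨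
      sum (map c T) + sum (map c (B ++ O))
    ≡⟨ trans (cong sum (map-++ c T (B ++ O))) (sum-++ (map c T) (map c (B ++ O))) ⟨
      sum (map c (T ++ B ++ O))
    ≡⟨ sum-↭ (map⁺ c arr) ⟩
      sum (map c L)
    ≡⟨ total ⟩
      2 * length L + 1
    ≡⟨ cong (λ n → 2 * n + 1) lengths ⟨
      2 * (length T + (length B + length O)) + 1 ∎
    where
      open ≡-Reasoning
      lengths : length T + (length B + length O) ≡ length L
      lengths = trans (cong (length T +_) (sym (length-++ B)))
                      (trans (sym (length-++ T)) (↭-length arr))

  -- There is an axis with c ≥ 3: otherwise the balance reads 2t + o = 2(t + o) + 1.
  no-bigs : ∀ t o → 2 * t + (0 + o) ≢ 2 * (t + (0 + o)) + 1
  no-bigs t o eq with +-cancelˡ-≡ (2 * t + o) 0 (suc o) (trans (lhs t o) (trans eq (rhs t o)))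
    where
      lhs : ∀ t o → (2 * t + o) + 0 ≡ 2 * t + (0 + o)
      lhs = solve-∀
      rhs : ∀ t o → 2 * (t + (0 + o)) + 1 ≡ (2 * t + o) + suc o
      rhs = solve-∀
  ... | ()

  -- With axes b ∷ bs of count ≥ 3, the balance says the ones exactly fill the fans.
  ones-fill : ∀ t N L o → 2 * t + ((3 + N + 2 * L) + o) ≡ 2 * (t + (suc L + o)) + 1 → o ≡ N
  ones-fill t N L o eq =
    sym (+-cancelˡ-≡ (2 * t + 3 + 2 * L + o) N o (trans (lhs t N L o) (trans eq (rhs t L o))))
    where
      lhs : ∀ t N L o → (2 * t + 3 + 2 * L + o) + N ≡ 2 * t + ((3 + N + 2 * L) + o)
      lhs = solve-∀
      rhs : ∀ t L o → 2 * (t + (suc L + o)) + 1 ≡ (2 * t + 3 + 2 * L + o) + o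
      rhs = solve-∀

  route-of : ∀ L → Unique L → All (λ h → 1 ≤ c h) L → sum (map c L) ≡ 2 * length L + 1 →
             Σ (List (Fin m)) λ G → G ↭ L × Route G
  route-of L L! L≥1 total with sort L L≥1
  ... | sorted T [] O arr cT [] cO = ⊥-elim (no-bigs (length T) (length O) (balance T [] O arr cT cO total))
  ... | sorted T (b ∷ bs) O arr cT cB cO =
    T ++ G₁ , arranged , bracket-all T cT (proj₂ (proj₂ fans)) (unique-↭ (↭-sym arranged) L!)
    where
      fits : length O ≡ onesNeeded b bs
      fits = ones-fill (length T) (onesNeeded b bs) (length bs) (length O)
               (trans (cong (λ s → 2 * length T + (s + length O)) (sym (bigs-total b bs cB)))
                      (balance T (b ∷ bs) O arr cT cO total))
      fans : Σ (List (Fin m)) λ G → G ↭ (b ∷ bs) ++ O × Route G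
      fans = chain b bs O cB cO fits (unique-suffix T (unique-↭ (↭-sym arr) L!))
      G₁ : List (Fin m)
      G₁ = proj₁ fans
      arranged : T ++ G₁ ↭ L
      arranged = ↭-trans (++⁺ˡ T (proj₁ (proj₂ fans))) arr

  counted-tour : (∀ g → 1 ≤ c g) → sum (map c (allFin m)) ≡ 2 * m + 1 →
                 Σ (List (Fin m)) λ w → Tour (allFin m) w × (∀ g → occ g w ≡ c g)
  counted-tour c≥1 total with route-of (allFin m) (allFin⁺ m) (All.tabulate λ {g} _ → c≥1 g)
                                         (trans total (cong (λ n → 2 * n + 1) (sym (length-tabulate {n = m} id))))
  ... | G , G↭ , route w t meets-G = w , tour-↭ G↭ t , λ g →
    trans (meets-G g) (demand-unique G (unique-↭ (↭-sym G↭) (allFin⁺ m)) (∈-resp-↭ (↭-sym G↭) (∈-allFin g)))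

opposite : ∀ {n} → Facet n → Facet n
opposite (a , s) = a , not s

module Development (m : ℕ) where
  open Rolling (opposite {suc m}) m

  -- F describes the placement P: F g is the facet adjacent to the bottom on the positive
  -- side of ground axis g, so that rolling onto it moves one cell up along g.
  record Tracks (P : Placement (suc m)) (F : Fin m → Facet (suc m)) : Set where
    field
      axis-ahead : ∀ g → axis P (proj₁ (F g)) ≡ g
      dir-ahead  : ∀ g → dir P (proj₁ (F g)) ≡ proj₂ (F g)
      beside     : ∀ g → proj₁ (F g) ≢ proj₁ (bottom P)
  open Tracks public

  forward : ∀ t e → e ≡ t → (if t then e else not e) ≡ true
  forward true  _ refl = refl
  forward false _ refl = refl

  turned : ∀ s {v} → v ≡ true → (if s then not v else v) ≡ not s
  turned true  refl = refl
  turned false refl = refl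

  roll-tracks : ∀ {P F} g → Tracks P F →
                Tracks (roll P (F g)) (updateAt F g (const (opposite (bottom P))))
  axis-ahead (roll-tracks {P} {F} g t) h with h ≟ g
  ... | yes refl rewrite updateAt-updates g {const (opposite (bottom P))} F =
    trans (if-same (proj₁ (bottom P))) (axis-ahead t g)
  ... | no h≢g rewrite updateAt-minimal h g {const (opposite (bottom P))} F h≢g =
    trans (if-diff (beside t h)) (axis-ahead t h)
  dir-ahead (roll-tracks {P} {F} g t) h with h ≟ g
  ... | yes refl rewrite updateAt-updates g {const (opposite (bottom P))} F =
    trans (if-same (proj₁ (bottom P))) (turned (proj₂ (bottom P)) (forward (proj₂ (F g)) _ (dir-ahead t g)))
  ... | no h≢g rewrite updateAt-minimal h g {const (opposite (bottom P))} F h≢g =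
    trans (if-diff (beside t h)) (dir-ahead t h)
  beside (roll-tracks {P} {F} g t) h with h ≟ g
  ... | yes refl rewrite updateAt-updates g {const (opposite (bottom P))} F =
    λ a≡b → beside t g (sym a≡b)
  ... | no h≢g rewrite updateAt-minimal h g {const (opposite (bottom P))} F h≢g =
    λ e → h≢g (trans (sym (axis-ahead t h)) (trans (cong (axis P) e) (axis-ahead t g)))

  cell-step : ∀ {P F} → Tracks P F → ∀ g h → cell (roll P (F g)) h ≡ cell P h +ℤ ℤ.+ δ h g
  cell-step {P} {F} t g h
    rewrite axis-ahead t g | forward (proj₂ (F g)) _ (dir-ahead t g) with h ≟ g
  ... | yes _ = refl
  ... | no  _ = sym (ℤProperties.+-identityʳ (cell P h))

  -- Developing along a word from a tracked placement, the largest cell coordinate along g₀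
  -- is the starting one plus the number of rolls along g₀ (coordinates only increase) ...
  highest : ∀ g₀ w {P F} j → Tracks P F → cell P g₀ ≡ ℤ.+ j →
            foldr (λ Q r → cell Q g₀ ⊔ℤ r) (ℤ.+ 0) (develop P (trail (state (bottom P) F) w))
              ≡ ℤ.+ (j + occ g₀ w)
  highest g₀ []      j t start rewrite start = cong ℤ.+_ (trans (⊔-identityʳ j) (sym (+-identityʳ j)))
  highest g₀ (h ∷ w) j t start
    rewrite highest g₀ w (j + δ g₀ h) (roll-tracks h t) (trans (cell-step t h g₀) (cong (_+ℤ ℤ.+ δ g₀ h) start))
          | start
    = cong ℤ.+_ (trans (m≤n⇒m⊔n≡n (≤-trans (m≤m+n j (δ g₀ h)) (m≤m+n _ _))) (+-assoc j _ _))

  lowest : ∀ g₀ w {P F} j → Tracks P F → cell P g₀ ≡ ℤ.+ j →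
           foldr (λ Q r → cell Q g₀ ⊓ℤ r) (ℤ.+ 0) (develop P (trail (state (bottom P) F) w)) ≡ ℤ.+ 0
  lowest g₀ []      j t start rewrite start = cong ℤ.+_ (⊓-zeroʳ j)
  lowest g₀ (h ∷ w) j t start
    rewrite lowest g₀ w (j + δ g₀ h) (roll-tracks h t) (trans (cell-step t h g₀) (cong (_+ℤ ℤ.+ δ g₀ h) start))
          | start
    = cong ℤ.+_ (⊓-zeroʳ j)

  trail-linked : ∀ w {P F} → Tracks P F → Linked ShareRidge (bottom P ∷ trail (state (bottom P) F) w)
  trail-linked []      t = [-]
  trail-linked (h ∷ w) t = (beside t h ∘ sym) ∷ trail-linked w (roll-tracks h t)

module StandardUnfolding (k : ℕ) where
  open Rolling (opposite {suc (suc k)}) (suc k)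
  open Development (suc k)

  -- Start with the facet x₀ = 0 on the ground and cube axis i + 1 along ground axis i,
  -- pointing backwards, so that the facet x_{i+1} = 0 lies ahead along ground axis i.
  base : Facet (suc (suc k))
  base = zero , false

  ahead₀ : Fin (suc k) → Facet (suc (suc k))
  ahead₀ g = suc g , false

  axis₀ : Fin (suc (suc k)) → Fin (suc k)
  axis₀ zero    = zero
  axis₀ (suc i) = i

  frame₀ : Placement (suc (suc k))
  frame₀ = placement base axis₀ (const false) (const 0ℤ)

  frame₀-valid : ValidFrame frame₀
  frame₀-valid zero    _       0≢0 _   _   = contradiction refl 0≢0
  frame₀-valid (suc i) zero    _   0≢0 _   = contradiction refl 0≢0
  frame₀-valid (suc i) (suc j) _   _   i≡j = cong suc i≡j

  tracks₀ : Tracks frame₀ ahead₀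
  tracks₀ = record { axis-ahead = λ _ → refl ; dir-ahead = λ _ → refl ; beside = λ _ () }

  allFacets : List (Facet (suc (suc k)))
  allFacets = cartesianProduct (allFin (suc (suc k))) (false ∷ true ∷ [])

  allFacets-unique : Unique allFacets
  allFacets-unique = cartesianProduct⁺ (allFin⁺ (suc (suc k))) (((λ ()) ∷ []) ∷ [] ∷ [])

  allFacets-complete : ∀ f → f ∈ allFacets
  allFacets-complete (i , s) = ∈-cartesianProduct⁺ (∈-allFin i) (bool∈ s)
    where
      bool∈ : ∀ s → s ∈ false ∷ true ∷ []
      bool∈ false = here refl
      bool∈ true  = there (here refl)

  flanks-tabulate : ∀ {j} (f : Fin j → Fin (suc k)) →
                    flanks ahead₀ (tabulate f) ≡ cartesianProductWith _,_ (tabulate (suc ∘ f)) (false ∷ true ∷ [])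
  flanks-tabulate {zero}  f = refl
  flanks-tabulate {suc j} f =
    cong (λ l → (suc (f zero) , false) ∷ (suc (f zero) , true) ∷ l) (flanks-tabulate (f ∘ suc))

  tour-facets : ∀ {w} → Tour (allFin (suc k)) w → base ∷ trail (state base ahead₀) w ↭ allFacets
  tour-facets t = ↭-trans (prep base (visits t (state base ahead₀)))
                          (↭-reflexive (cong (λ l → base ∷ opposite base ∷ l) (flanks-tabulate id)))

  pathUnfolding : ∀ w → Tour (allFin (suc k)) w → PathUnfolding (suc (suc k))
  pathUnfolding w t = record
    { start       = base
    ; rest        = trail (state base ahead₀) w
    ; covers      = λ f → ∈-resp-↭ (↭-sym (tour-facets t)) (allFacets-complete f)
    ; unique      = unique-↭ (↭-sym (tour-facets t)) allFacets-unique
    ; linked      = trail-linked w tracks₀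
    ; frame       = frame₀
    ; frameBottom = refl
    ; frameValid  = frame₀-valid
    }

  pathUnfolding-box : ∀ w (t : Tour (allFin (suc k)) w) i → boxSide (pathUnfolding w t) i ≡ suc (occ i w)
  pathUnfolding-box w t i rewrite highest i w 0 tracks₀ refl | lowest i w 0 tracks₀ refl =
    cong suc (+-identityʳ (occ i w))

sum-minus-one : ∀ {A : Set} (p : A → ℕ) L → All (λ x → 1 ≤ p x) L →
                sum (map p L) ≡ sum (map (λ x → p x ∸ 1) L) + length L
sum-minus-one p []      []         = refl
sum-minus-one p (x ∷ L) (px ∷ pL) = begin
    p x + sum (map p L)                                  ≡⟨ cong₂ _+_ (sym (m+[n∸m]≡n px)) (sum-minus-one p L pL) ⟩
    suc (p x ∸ 1) + (sum (map (λ y → p y ∸ 1) L) + length L) ≡⟨ rearrange (p x ∸ 1) _ (length L) ⟩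
    (p x ∸ 1) + sum (map (λ y → p y ∸ 1) L) + suc (length L) ∎
  where
    open ≡-Reasoning
    rearrange : ∀ a b l → suc a + (b + l) ≡ a + b + suc l
    rearrange = solve-∀

counts-from-sides : ∀ k (p : Fin (suc k) → ℕ) → (∀ i → 1 ≤ p i) →
                    sum (tabulate p) ≡ 3 * suc (suc k) ∸ 2 →
                    sum (map (λ i → p i ∸ 1) (allFin (suc k))) ≡ 2 * suc k + 1
counts-from-sides k p p≥1 total = +-cancelʳ-≡ (suc k) _ _ (begin
    sum (map (λ i → p i ∸ 1) (allFin (suc k))) + suc k
  ≡⟨ cong (sum (map (λ i → p i ∸ 1) (allFin (suc k))) +_) (length-tabulate {n = suc k} id) ⟨
    sum (map (λ i → p i ∸ 1) (allFin (suc k))) + length (allFin (suc k))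
  ≡⟨ sum-minus-one p (allFin (suc k)) (All.tabulate λ {i} _ → p≥1 i) ⟨
    sum (map p (allFin (suc k)))
  ≡⟨ cong sum (map-tabulate id p) ⟩
    sum (tabulate p)
  ≡⟨ total ⟩
    k + (suc (suc k) + (suc (suc k) + 0))
  ≡⟨ rearrange k ⟩
    2 * suc k + 1 + suc k ∎)
  where
    open ≡-Reasoning
    rearrange : ∀ k → k + (suc (suc k) + (suc (suc k) + 0)) ≡ 2 * suc k + 1 + suc k
    rearrange = solve-∀

mainTheorem3 : ∀ (n : ℕ) → 2 ≤ n → (p : Fin (n ∸ 1) → ℕ) → (∀ i → 2 ≤ p i) →
    sum (tabulate p) ≡ 3 * n ∸ 2 →
    Σ (PathUnfolding n) λ U → ∃ λ (π : Permutation′ (n ∸ 1)) →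
      ∀ i → boxSide U (π ⟨$⟩ʳ i) ≡ p i
mainTheorem3 (suc (suc k)) (s≤s (s≤s z≤n)) p p≥2 total =
  pathUnfolding w t , Permutation.id , λ i → begin
    boxSide (pathUnfolding w t) i ≡⟨ pathUnfolding-box w t i ⟩
    suc (occ i w)             ≡⟨ cong suc (counts i) ⟩
    suc (p i ∸ 1)             ≡⟨ m+[n∸m]≡n (p≥1 i) ⟩
    p i                       ∎
  where
    open StandardUnfolding k
    open ≡-Reasoning
    p≥1 : ∀ i → 1 ≤ p i
    p≥1 i = ≤-trans (s≤s z≤n) (p≥2 i)
    counted : Σ (List (Fin (suc k))) λ w → Rolling.Tour opposite (suc k) (allFin (suc k)) w × (∀ i → occ i w ≡ p i ∸ 1)
    counted = Assembly.counted-tour opposite (suc k) (λ i → p i ∸ 1)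
                (λ i → ∸-monoˡ-≤ 1 (p≥2 i)) (counts-from-sides k p p≥1 total)
    w : List (Fin (suc k))
    w = proj₁ counted
    t : Rolling.Tour opposite (suc k) (allFin (suc k)) w
    t = proj₁ (proj₂ counted)
    counts : ∀ i → occ i w ≡ p i ∸ 1
    counts = proj₂ (proj₂ counted)
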